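{- The complete multirooted non-ambiguous binary trees with a single root are precisely the complete non-ambiguous binary trees. That is, every complete non-ambiguous binary tree on an $n\times n$ grid is a complete multirooted non-ambiguous binary tree (arising from $\mathcal{T}_\pi$ for some $\pi\in\mathfrak{S}_n$) with a single root, and every complete multirooted non-ambiguous binary tree with a single root is a complete non-ambiguous binary tree.
   Context: A non-ambiguous binary tree (NAB) is a filling of a rectangular grid with empty or dotted cells such that every row and column contains a dot, and every dotted cell except the top-left one has a dotted cell above it in its column or to its left in its row, but not both; joining each dot to the nearest dot above it or to its left gives a binary tree. It is complete (a CNAB) if each dotted cell has either both a dot below it in its column and a dot to its right in its row, or neither. For $\pi\in\mathfrak{S}_n$, $\mathcal{T}_\pi$ is the $n\times n$ grid (cell $(i,j)$ = row $i$ from top, column $j$ from left) with dots in cells $(\pi_i,i)$. A complete multirooted non-ambiguous binary tree (CMNAB) is obtained from some $\mathcal{T}_\pi$ by adding $n-1$ dots (internal dots) in empty cells such that (1) every internal dot has a dot below it in its column and a dot to its right in its row; (2) the graph on all dots joining consecutive dots in a common row or column is a tree. A root is a dot with no dot to its left in its row and no dot above it in its column. -}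

module Defs where

open import Data.Nat using (ℕ; zero; suc; _∸_; _≤_) renaming (_<_ to _<ℕ_)
open import Data.Bool using (Bool; true; false; _∨_; if_then_else_)
open import Data.Fin using (Fin; _<_; _≟_; toℕ)
open import Data.Fin.Permutation using (Permutation′; _⟨$⟩ʳ_)
open import Data.List using (List; []; _∷_; length; map; allFin; _∷ʳ_)
open import Data.Nat.ListAction using (sum)
open import Data.List.Relation.Unary.Linked using (Linked)
open import Data.List.Relation.Unary.Unique.Propositional using (Unique)
open import Data.Product using (Σ; ∃; _×_; _,_)
open import Data.Sum using (_⊎_)
open import Relation.Nullary using (¬_)
open import Relation.Nullary.Decidable using (⌊_⌋)
open import Relation.Binary.PropositionalEquality using (_≡_; _≢_)
open import Relation.Binary.Construct.Closure.ReflexiveTransitive using (Star)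

-- A filling of an m × n grid: D i j = true iff cell (i , j) (row i from the
-- top, column j from the left, 0-indexed) is dotted.
Grid : ℕ → ℕ → Set
Grid m n = Fin m → Fin n → Bool

Cell : ℕ → ℕ → Set
Cell m n = Fin m × Fin n

count : {m n : ℕ} → Grid m n → ℕ
count {m} {n} P =
  sum (map (λ i → sum (map (λ j → if P i j then 1 else 0) (allFin n))) (allFin m))

module _ {m n : ℕ} (D : Grid m n) where

  Dotted : Fin m → Fin n → Set
  Dotted i j = D i j ≡ true

  DotAbove DotBelow : Fin m → Fin n → Set
  DotAbove i j = Σ (Fin m) λ i' → i' < i × Dotted i' j
  DotBelow i j = Σ (Fin m) λ i' → i < i' × Dotted i' j

  DotLeft DotRight : Fin m → Fin n → Set
  DotLeft  i j = Σ (Fin n) λ j' → j' < j × Dotted i j'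
  DotRight i j = Σ (Fin n) λ j' → j < j' × Dotted i j'

  IsNAB : Set
  IsNAB =
    (∀ i → Σ (Fin n) λ j → Dotted i j) ×
    (∀ j → Σ (Fin m) λ i → Dotted i j) ×
    (∀ i j → Dotted i j → ¬ (toℕ i ≡ 0 × toℕ j ≡ 0) →
       (DotAbove i j × ¬ DotLeft i j) ⊎ (¬ DotAbove i j × DotLeft i j))

  IsCNAB : Set
  IsCNAB = IsNAB ×
    (∀ i j → Dotted i j →
       (DotBelow i j × DotRight i j) ⊎ (¬ DotBelow i j × ¬ DotRight i j))

  IsRoot : Fin m → Fin n → Set
  IsRoot i j = Dotted i j × ¬ DotLeft i j × ¬ DotAbove i j

  SingleRoot : Set
  SingleRoot = Σ (Cell m n) λ { (i , j) →
    IsRoot i j × (∀ i' j' → IsRoot i' j' → (i' ≡ i × j' ≡ j)) }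

  Between : ℕ → ℕ → ℕ → Set
  Between a x b = (a <ℕ x × x <ℕ b) ⊎ (b <ℕ x × x <ℕ a)

  Adj : Cell m n → Cell m n → Set
  Adj (i , j) (i' , j') =
    Dotted i j × Dotted i' j' × ¬ (i ≡ i' × j ≡ j') ×
    ( (i ≡ i' × (∀ k → Between (toℕ j) (toℕ k) (toℕ j') → ¬ Dotted i k))
    ⊎ (j ≡ j' × (∀ k → Between (toℕ i) (toℕ k) (toℕ i') → ¬ Dotted k j)))

  Connected : Set
  Connected = ∀ i j i' j' → Dotted i j → Dotted i' j' → Star Adj (i , j) (i' , j')

  HasCycle : Set
  HasCycle = Σ (Cell m n) λ v → Σ (List (Cell m n)) λ ws →
    3 ≤ length (v ∷ ws) × Unique (v ∷ ws) × Linked Adj ((v ∷ ws) ∷ʳ v)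

  IsTreeGraph : Set
  IsTreeGraph = Connected × ¬ HasCycle

-- T_π : dots in cells (π i , i), i.e. row π(i), column i.

T : {n : ℕ} → Permutation′ n → Grid n n
T π i j = ⌊ i ≟ π ⟨$⟩ʳ j ⌋

IsCMNAB : {n : ℕ} → Grid n n → Set
IsCMNAB {n} D = Σ (Permutation′ n) λ π → Σ (Grid n n) λ I →
  (∀ i j → I i j ≡ true → T π i j ≡ false) ×
  count I ≡ n ∸ 1 ×
  (∀ i j → D i j ≡ (T π i j ∨ I i j)) ×
  (∀ i j → I i j ≡ true → DotBelow D i j × DotRight D i j) ×
  IsTreeGraph D

-- In a CNAB a dot has no dot below it exactly when it has no dot to its right, so the lowest dot
-- of each column is the rightmost dot of its row; these leaves are the dots of some T π, and the
-- other dots are internal, with dots below and to the right. Every dot but the top-left one has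
-- exactly one parent, the nearest dot to its left or above it, so the dot graph is a tree: every
-- dot descends to the top-left one, the only root, and a walk that climbs in i + j can never turn
-- back down. All but one dot of each row has a dot to its left, all but one of each column a dot
-- above it, and all but one dot exactly one of the two; hence there are 2N − 1 dots, of which
-- N − 1 are internal.
-- Conversely, the single root of a CMNAB is the top-left cell, so every other dot has a dot to
-- its left or above it. It cannot have both: descending from the two nearest ones along
-- decreasing i + j joins them by a path below them, closing a cycle. The dots of T π are leaves
-- because the other dots of their row and column are internal, with further dots beyond them.

module Submission where

open import Defs
open import Data.Nat using (ℕ; zero; suc; _+_; _≤_; _<_; _⊔_; s≤s; s≤s⁻¹; z≤n; _≤?_)
  renaming (_≟_ to _≟ℕ_)
open import Data.Nat.Properties
  using (<-trans; <-irrefl; <-asym; <-cmp; ≤-refl; <-≤-trans; ≤-<-trans; <⇒≤; ≰⇒>; n≮0; n≢0⇒n>0;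
         n≤0⇒n≡0; +-comm; +-suc; +-monoˡ-<; +-monoʳ-<; +-cancelˡ-≡; +-cancelʳ-≡; +-cancelˡ-<;
         +-cancelʳ-<; m+n≡0⇒m≡0; m+n≡0⇒n≡0; suc-injective; m≤m⊔n; m≤n⊔m; ⊔-lub; ⊔-monoˡ-≤;
         ⊔-monoʳ-≤; +-0-commutativeMonoid)
open import Data.Nat.Tactic.RingSolver using (solve-∀)
import Data.Nat.ListAction as List
open import Data.Bool using (Bool; true; false; _∧_; _∨_; not; if_then_else_) renaming (_≟_ to _≟ᵇ_)
open import Data.Fin using (Fin; zero; suc; _≟_; toℕ) renaming (_<_ to _<ᶠ_)
open import Data.Fin.Properties using (any?; _<?_; toℕ-injective) renaming (<-cmp to <ᶠ-cmp)
open import Data.Fin.Permutation using (Permutation′; _⟨$⟩ʳ_; _⟨$⟩ˡ_; inverseʳ; permutation)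
open import Data.List using (List; []; _∷_; _∷ʳ_; length; map; allFin; tabulate)
open import Data.List.Properties using (length-++; map-tabulate)
open import Data.List.Relation.Unary.All as All using (All; []; _∷_)
import Data.List.Relation.Unary.All.Properties as All
open import Data.List.Relation.Unary.AllPairs using ([]; _∷_)
import Data.List.Relation.Unary.AllPairs.Properties as AllPairs
open import Data.List.Relation.Unary.Linked using (Linked; []; [-]; _∷_)
open import Data.List.Relation.Unary.Linked.Properties using (Linked⇒All)
open import Data.List.Relation.Unary.Unique.Propositional using (Unique)
open import Data.Product as Product using (Σ; ∃; _×_; _,_; proj₁; proj₂)
open import Data.Product.Properties using (≡-dec)
open import Data.Sum as Sum using (_⊎_; inj₁; inj₂; [_,_]′)
open import Data.Empty using (⊥; ⊥-elim)
open import Data.Unit using (⊤; tt)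
open import Function using (_∘_; _on_)
open import Function.Bundles using (Injection)
open import Function.Properties.Inverse using (↔⇒↣)
open import Level using (0ℓ)
open import Relation.Nullary using (¬_; Dec; yes; no; does; contradiction)
open import Relation.Nullary.Decidable using (⌊_⌋; _×-dec_; decidable-stable)
open import Relation.Unary using (Decidable)
open import Relation.Binary.Core using (Rel)
open import Relation.Binary.Definitions using (Symmetric; DecidableEquality; tri<; tri≈; tri>)
open import Relation.Binary.PropositionalEquality
  using (_≡_; _≢_; refl; sym; trans; cong; cong₂; subst; ≢-sym)
open Relation.Binary.PropositionalEquality.≡-Reasoning
open import Relation.Binary.Construct.Closure.ReflexiveTransitive
  using (Star; ε; _◅_; _◅◅_; reverse)
open import Algebra.Properties.CommutativeMonoid.Sum +-0-commutativeMonoid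
  using (sum-syntax; sum-cong-≗; sum-replicate-zero; ∑-distrib-+; ∑-comm)

χ : Bool → ℕ
χ b = if b then 1 else 0

∑-0 : ∀ n → ∑[ i < n ] 0 ≡ 0
∑-0 = sum-replicate-zero

∑-1 : ∀ n → ∑[ i < n ] 1 ≡ n
∑-1 zero    = refl
∑-1 (suc n) = cong suc (∑-1 n)

⌊≟⌋-suc : ∀ {n} (j k : Fin n) → ⌊ suc j ≟ suc k ⌋ ≡ ⌊ j ≟ k ⌋
⌊≟⌋-suc j k with j ≟ k
... | yes _ = refl
... | no  _ = refl

∑-δ : ∀ {n} (k : Fin n) → ∑[ j < n ] χ ⌊ j ≟ k ⌋ ≡ 1
∑-δ {suc n} zero    = cong suc (∑-0 n)
∑-δ {suc n} (suc k) = trans (sum-cong-≗ (λ j → cong χ (⌊≟⌋-suc j k))) (∑-δ k)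

∑₂ : ∀ {m n} → (Fin m → Fin n → ℕ) → ℕ
∑₂ {m} {n} f = ∑[ i < m ] ∑[ j < n ] f i j

∑₂-cong : ∀ {m n} {f g : Fin m → Fin n → ℕ} → (∀ i j → f i j ≡ g i j) → ∑₂ f ≡ ∑₂ g
∑₂-cong f≗g = sum-cong-≗ (λ i → sum-cong-≗ (f≗g i))

∑₂-distrib-+ : ∀ {m n} (f g : Fin m → Fin n → ℕ) → ∑₂ (λ i j → f i j + g i j) ≡ ∑₂ f + ∑₂ g
∑₂-distrib-+ {n = n} f g =
  trans (sum-cong-≗ (λ i → ∑-distrib-+ (f i) (g i)))
        (∑-distrib-+ (λ i → ∑[ j < n ] f i j) (λ i → ∑[ j < n ] g i j))

∑₂-origin : ∀ {m n} → ∑₂ {suc m} {suc n} (λ i j → χ (⌊ i ≟ zero ⌋ ∧ ⌊ j ≟ zero ⌋)) ≡ 1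
∑₂-origin {m} {n} =
  cong₂ _+_ (∑-δ {suc n} zero) (trans (sum-cong-≗ {n = m} (λ _ → ∑-0 (suc n))) (∑-0 m))

sum-tabulate : ∀ {n} (f : Fin n → ℕ) → List.sum (tabulate f) ≡ ∑[ i < n ] f i
sum-tabulate {zero}  f = refl
sum-tabulate {suc n} f = cong (f zero +_) (sum-tabulate (λ i → f (suc i)))

sum-allFin : ∀ {n} (f : Fin n → ℕ) → List.sum (map f (allFin n)) ≡ ∑[ i < n ] f i
sum-allFin f = trans (cong List.sum (map-tabulate (λ i → i) f)) (sum-tabulate f)

count≡∑₂ : ∀ {m n} (G : Grid m n) → count G ≡ ∑₂ (λ i j → χ (G i j))
count≡∑₂ {m} {n} G =
  trans (sum-allFin (λ i → List.sum (map (λ j → χ (G i j)) (allFin n))))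
        (sum-cong-≗ (λ i → sum-allFin (λ j → χ (G i j))))

χ-exactly-one : ∀ {A B : Set} (a? : Dec A) (b? : Dec B) → (A → ¬ B) → (¬ A → B) →
                χ (does a?) + χ (does b?) ≡ 1
χ-exactly-one (yes a) (yes b) a⇒¬b _    = contradiction b (a⇒¬b a)
χ-exactly-one (yes _) (no _)  _    _    = refl
χ-exactly-one (no _)  (yes _) _    _    = refl
χ-exactly-one (no ¬a) (no ¬b) _    ¬a⇒b = contradiction (¬a⇒b ¬a) ¬b

χ-neither : ∀ {A B : Set} (a? : Dec A) (b? : Dec B) → ¬ A → ¬ B → χ (does a?) + χ (does b?) ≡ 0
χ-neither (yes a) _       ¬a _  = contradiction a ¬a
χ-neither (no _)  (yes b) _  ¬b = contradiction b ¬b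
χ-neither (no _)  (no _)  _  _  = refl

double-count : ∀ {d l a m n} → d ≡ m + l → d ≡ n + a → d ≡ suc (l + a) → suc d ≡ m + n
double-count {d} {l} {a} {m} {n} d≡m+l d≡n+a d≡1+l+a = +-cancelˡ-≡ (l + a) _ _ (begin
  (l + a) + suc d    ≡⟨ +-suc (l + a) d ⟩
  suc (l + a) + d    ≡⟨ cong (_+ d) (sym d≡1+l+a) ⟩
  d + d              ≡⟨ cong₂ _+_ d≡m+l d≡n+a ⟩
  (m + l) + (n + a)  ≡⟨ rearrange m n l a ⟩
  (l + a) + (m + n)  ∎)
  where
  rearrange : ∀ m n l a → (m + l) + (n + a) ≡ (l + a) + (m + n)
  rearrange = solve-∀

least : ∀ {k} (P : Fin k → Set) → Decidable P → ∃ P →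
        Σ (Fin k) λ x → P x × (∀ y → y <ᶠ x → ¬ P y)
least {suc k} P P? w with P? zero
... | yes p = zero , p , λ _ ()
least {suc k} P P? (zero  , p) | no ¬p = contradiction p ¬p
least {suc k} P P? (suc y , p) | no ¬p with least (λ x → P (suc x)) (λ x → P? (suc x)) (y , p)
... | x , px , h = suc x , px , λ { zero _ → ¬p ; (suc y) (s≤s y<x) → h y y<x }

greatest : ∀ {k} (P : Fin k → Set) → Decidable P → ∃ P →
           Σ (Fin k) λ x → P x × (∀ y → x <ᶠ y → ¬ P y)
greatest {suc k} P P? w with any? (λ x → P? (suc x))
... | yes w′ with greatest (λ x → P (suc x)) (λ x → P? (suc x)) w′
...   | x , px , h = suc x , px , λ { zero () ; (suc y) (s≤s x<y) → h y x<y }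
greatest {suc k} P P? (zero  , p) | no ¬w = zero , p , λ { zero () ; (suc y) _ py → ¬w (y , py) }
greatest {suc k} P P? (suc y , p) | no ¬w = contradiction (y , p) ¬w

module Line {k : ℕ} (L : Fin k → Bool) where

  Dot : Fin k → Set
  Dot x = L x ≡ true

  Before After : Fin k → Set
  Before x = Σ (Fin k) λ y → y <ᶠ x × Dot y
  After  x = Σ (Fin k) λ y → x <ᶠ y × Dot y

  Gap : Fin k → Fin k → Set
  Gap y x = ∀ z → y <ᶠ z → z <ᶠ x → ¬ Dot z

  dot? : Decidable Dot
  dot? x = L x ≟ᵇ true

  before? : Decidable Before
  before? x = any? λ y → (y <? x) ×-dec dot? y

  first : ∃ Dot → Σ (Fin k) λ x → Dot x × ¬ Before x
  first w with least Dot dot? w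
  ... | x , dx , h = x , dx , λ (y , y<x , dy) → h y y<x dy

  last : ∃ Dot → Σ (Fin k) λ x → Dot x × ¬ After x
  last w with greatest Dot dot? w
  ... | x , dx , h = x , dx , λ (y , x<y , dy) → h y x<y dy

  first-unique : ∀ {x y} → Dot x → ¬ Before x → Dot y → ¬ Before y → x ≡ y
  first-unique {x} {y} dx ¬bx dy ¬by with <ᶠ-cmp x y
  ... | tri< x<y _ _ = contradiction (x , x<y , dx) ¬by
  ... | tri≈ _ x≡y _ = x≡y
  ... | tri> _ _ y<x = contradiction (y , y<x , dy) ¬bx

  last-unique : ∀ {x y} → Dot x → ¬ After x → Dot y → ¬ After y → x ≡ y
  last-unique {x} {y} dx ¬ax dy ¬ay with <ᶠ-cmp x y
  ... | tri< x<y _ _ = contradiction (y , x<y , dy) ¬ax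
  ... | tri≈ _ x≡y _ = x≡y
  ... | tri> _ _ y<x = contradiction (x , y<x , dx) ¬ay

  nearest-before : ∀ {x} → Before x → Σ (Fin k) λ y → y <ᶠ x × Dot y × Gap y x
  nearest-before {x} b with greatest (λ y → y <ᶠ x × Dot y) (λ y → (y <? x) ×-dec dot? y) b
  ... | y , (y<x , dy) , h = y , y<x , dy , λ z y<z z<x dz → h z y<z (z<x , dz)

  nearest-unique : ∀ {x y y′} → y <ᶠ x → y′ <ᶠ x → Dot y → Dot y′ → Gap y x → Gap y′ x → y ≡ y′
  nearest-unique {y = y} {y′} y<x y′<x dy dy′ gap gap′ with <ᶠ-cmp y y′
  ... | tri< y<y′ _ _ = contradiction dy′ (gap y′ y<y′ y′<x)
  ... | tri≈ _ y≡y′ _ = y≡y′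
  ... | tri> _ _ y′<y = contradiction dy (gap′ y y′<y y<x)

  only-exception-is-last : ∀ {p} → (∀ x → Dot x → x ≢ p → After x) → Dot p → ¬ After p
  only-exception-is-last {p} others dp (y , p<y , dy) with last (y , dy)
  ... | x , dx , ¬ax with x ≟ p
  ...   | yes refl = ¬ax (y , p<y , dy)
  ...   | no x≢p   = ¬ax (others x dx x≢p)

  χ-first-split : ∀ {f} → Dot f → ¬ Before f →
    ∀ x → χ (L x) ≡ χ ⌊ x ≟ f ⌋ + χ (L x ∧ does (before? x))
  χ-first-split {f} df ¬bf x with L x in dx | x ≟ f | before? x
  ... | false | yes refl | _     = contradiction (trans (sym dx) df) λ ()
  ... | false | no _     | _     = refl
  ... | true  | yes refl | yes b = contradiction b ¬bf
  ... | true  | yes refl | no _  = refl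
  ... | true  | no _     | yes _ = refl
  ... | true  | no x≢f   | no ¬b = contradiction (first-unique dx ¬b df ¬bf) x≢f

  dots-with-dot-before : ∃ Dot → ∑[ x < k ] χ (L x) ≡ suc (∑[ x < k ] χ (L x ∧ does (before? x)))
  dots-with-dot-before w with first w
  ... | f , df , ¬bf =
    trans (sum-cong-≗ (χ-first-split df ¬bf))
          (trans (∑-distrib-+ (λ x → χ ⌊ x ≟ f ⌋) (λ x → χ (L x ∧ does (before? x))))
                 (cong (_+ _) (∑-δ f)))

-- Walks and cycles

module _ {C : Set} where

  length-∷ʳ : ∀ (xs : List C) {x} → length (xs ∷ʳ x) ≡ suc (length xs)
  length-∷ʳ xs = trans (length-++ xs) (+-comm (length xs) 1)

  unique-∷ʳ : ∀ {xs : List C} {x} → Unique xs → All (_≢ x) xs → Unique (xs ∷ʳ x)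
  unique-∷ʳ uniq xs≢x = AllPairs.++⁺ uniq ([] ∷ []) (All.map (_∷ []) xs≢x)

  unique-rotate : ∀ {x} {xs : List C} → Unique (x ∷ xs) → Unique (xs ∷ʳ x)
  unique-rotate (x∉xs ∷ uniq) = unique-∷ʳ uniq (All.map ≢-sym x∉xs)

  linked-∷ʳ : ∀ {R : Rel C 0ℓ} xs {x y} → Linked R (xs ∷ʳ x) → R x y → Linked R (xs ∷ʳ x ∷ʳ y)
  linked-∷ʳ []           [-]        r = r ∷ [-]
  linked-∷ʳ (_ ∷ [])     (p ∷ [-])  r = p ∷ r ∷ [-]
  linked-∷ʳ (_ ∷ b ∷ xs) (p ∷ walk) r = p ∷ linked-∷ʳ (b ∷ xs) walk r

  NonBacktracking : List C → Set
  NonBacktracking (x ∷ y ∷ z ∷ zs) = x ≢ z × NonBacktracking (y ∷ z ∷ zs)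
  NonBacktracking _                = ⊤

  unique⇒nonBacktracking : ∀ {xs} → Unique xs → NonBacktracking xs
  unique⇒nonBacktracking {_ ∷ _ ∷ _ ∷ _} ((_ ∷ x≢z ∷ _) ∷ uniq) = x≢z , unique⇒nonBacktracking uniq
  unique⇒nonBacktracking {[]}         _ = tt
  unique⇒nonBacktracking {_ ∷ []}     _ = tt
  unique⇒nonBacktracking {_ ∷ _ ∷ []} _ = tt

  closed-nonBacktracking : ∀ {v w u us} → Unique (v ∷ w ∷ u ∷ us) →
                           NonBacktracking ((v ∷ w ∷ u ∷ us) ∷ʳ v)
  closed-nonBacktracking uniq@((_ ∷ v≢u ∷ _) ∷ _) =
    v≢u , unique⇒nonBacktracking (unique-rotate uniq)

  CycleThrough : Rel C 0ℓ → C → Set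
  CycleThrough _~_ v = Σ (List C) λ ws →
    3 ≤ length (v ∷ ws) × Unique (v ∷ ws) × Linked _~_ ((v ∷ ws) ∷ʳ v)

  Cycle : Rel C 0ℓ → Set
  Cycle _~_ = Σ C (CycleThrough _~_)

  rotate : ∀ {_~_ : Rel C 0ℓ} {v w} ws → 3 ≤ length (v ∷ w ∷ ws) → Unique (v ∷ w ∷ ws) →
           Linked _~_ ((v ∷ w ∷ ws) ∷ʳ v) → CycleThrough _~_ w
  rotate {w = w} ws len uniq (v~w ∷ walk) =
    ws ∷ʳ _ , subst (λ l → 3 ≤ suc l) (sym (length-∷ʳ ws)) len ,
    unique-rotate uniq , linked-∷ʳ (w ∷ ws) walk v~w

module PeakFree {C : Set} (_~_ : Rel C 0ℓ) (μ : C → ℕ)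
  (~-sym : Symmetric _~_)
  (μ-differs : ∀ {a b} → a ~ b → μ a ≢ μ b)
  (lower-neighbour-unique : ∀ {w a b} → w ~ a → w ~ b → μ a < μ w → μ b < μ w → a ≡ b)
  where

  ascent-continues : ∀ {x y z} → x ~ y → y ~ z → x ≢ z → μ x < μ y → μ y < μ z
  ascent-continues {x} {y} {z} x~y y~z x≢z μx<μy with <-cmp (μ y) (μ z)
  ... | tri< μy<μz _ _ = μy<μz
  ... | tri≈ _ μy≡μz _ = contradiction μy≡μz (μ-differs y~z)
  ... | tri> _ _ μz<μy = contradiction (lower-neighbour-unique (~-sym x~y) y~z μx<μy μz<μy) x≢z

  ascending : ∀ {x y zs} → Linked _~_ (x ∷ y ∷ zs) → NonBacktracking (x ∷ y ∷ zs) →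
              μ x < μ y → Linked (_<_ on μ) (x ∷ y ∷ zs)
  ascending (_ ∷ [-])          _          μx<μy = μx<μy ∷ [-]
  ascending (x~y ∷ y~z ∷ walk) (x≢z , nb) μx<μy =
    μx<μy ∷ ascending (y~z ∷ walk) nb (ascent-continues x~y y~z x≢z μx<μy)

  -- A cycle whose first step rises keeps rising and cannot return to its start; otherwise it is
  -- restarted one step later, at a vertex of smaller μ.
  no-cycle-below : ∀ b {v} → μ v < b → ¬ CycleThrough _~_ v
  no-cycle-below (suc b) {v} μv≤b (w ∷ u ∷ us , len , uniq , walk@(v~w ∷ _)) with <-cmp (μ v) (μ w)
  ... | tri< μv<μw _ _ with ascending walk (closed-nonBacktracking uniq) μv<μw
  ...   | _ ∷ ascent =
    <-irrefl refl (proj₂ (All.∷ʳ⁻ {xs = w ∷ u ∷ us} (Linked⇒All <-trans μv<μw ascent)))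
  no-cycle-below (suc b) _ (_ ∷ _ ∷ _ , _ , _ , v~w ∷ _) | tri≈ _ μv≡μw _ = μ-differs v~w μv≡μw
  no-cycle-below (suc b) μv≤b (w ∷ u ∷ us , len , uniq , walk) | tri> _ _ μw<μv =
    no-cycle-below b (<-≤-trans μw<μv (s≤s⁻¹ μv≤b)) (rotate (u ∷ us) len uniq walk)
  no-cycle-below _ _ (_ ∷ [] , s≤s (s≤s ()) , _)
  no-cycle-below _ _ ([] , s≤s () , _)

  acyclic : ¬ Cycle _~_
  acyclic (v , cycle) = no-cycle-below (suc (μ v)) ≤-refl cycle

module Descending {C : Set} (_~_ : Rel C 0ℓ) (μ : C → ℕ) (V : C → Set) (_≟C_ : DecidableEquality C)
  (~-sym : Symmetric _~_)
  (~-V : ∀ {a b} → a ~ b → V b)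
  (ground-unique : ∀ {x y} → V x → V y → μ x ≡ 0 → μ y ≡ 0 → x ≡ y)
  (descend : ∀ {x} → V x → 0 < μ x → Σ C λ y → x ~ y × μ y < μ x)
  where

  <μ⇒≢ : ∀ {x y} → μ x < μ y → x ≢ y
  <μ⇒≢ μx<μy refl = <-irrefl refl μx<μy

  to-ground : ∀ b {x} → V x → μ x < b → Σ C λ z → V z × μ z ≡ 0 × Star _~_ x z
  to-ground (suc b) {x} vx μx≤b with μ x ≟ℕ 0
  ... | yes μx≡0 = x , vx , μx≡0 , ε
  ... | no  μx≢0 with descend vx (n≢0⇒n>0 μx≢0)
  ...   | y , x~y , μy<μx with to-ground b (~-V x~y) (<-≤-trans μy<μx (s≤s⁻¹ μx≤b))
  ...     | z , vz , μz≡0 , y↝z = z , vz , μz≡0 , x~y ◅ y↝z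

  connected : ∀ {x y} → V x → V y → Star _~_ x y
  connected vx vy with to-ground _ vx ≤-refl | to-ground _ vy ≤-refl
  ... | z , vz , μz≡0 , x↝z | z′ , vz′ , μz′≡0 , y↝z′ with ground-unique vz vz′ μz≡0 μz′≡0
  ...   | refl = x↝z ◅◅ reverse ~-sym y↝z′

  Path : C → C → Set
  Path x y = Σ (List C) λ ms →
    Linked _~_ (x ∷ ms ∷ʳ y) × Unique (x ∷ ms ∷ʳ y) × All (λ z → μ z < μ x ⊔ μ y) ms

  edge-path : ∀ {x y} → x ~ y → x ≢ y → Path x y
  edge-path x~y x≢y = [] , x~y ∷ [-] , (x≢y ∷ []) ∷ [] ∷ [] , []

  prepend : ∀ {x x′ y} → x ~ x′ → μ x′ < μ x → μ y ≤ μ x → x ≢ y → Path x′ y → Path x y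
  prepend {x} {x′} {y} x~x′ μx′<μx μy≤μx x≢y (ms , walk , uniq , below) =
    x′ ∷ ms , x~x′ ∷ walk , x∉ ∷ uniq ,
    <-≤-trans μx′<μx (m≤m⊔n _ _) ∷
    All.map (λ lt → <-≤-trans lt (⊔-monoˡ-≤ (μ y) (<⇒≤ μx′<μx))) below
    where
    x∉ : All (x ≢_) (x′ ∷ ms ∷ʳ y)
    x∉ = ≢-sym (<μ⇒≢ μx′<μx) ∷
         All.∷ʳ⁺ (All.map (λ lt → ≢-sym (<μ⇒≢ (<-≤-trans lt (⊔-lub (<⇒≤ μx′<μx) μy≤μx)))) below) x≢y

  append : ∀ {x y′ y} → Path x y′ → y′ ~ y → μ x < μ y → μ y′ < μ y → x ≢ y → Path x y
  append {x} {y′} {y} (ms , walk , uniq , below) y′~y μx<μy μy′<μy x≢y =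
    ms ∷ʳ y′ , linked-∷ʳ (x ∷ ms) walk y′~y , unique-∷ʳ uniq ∉y ,
    All.∷ʳ⁺ (All.map (λ lt → <-≤-trans lt (⊔-monoʳ-≤ (μ x) (<⇒≤ μy′<μy))) below)
            (<-≤-trans μy′<μy (m≤n⊔m _ _))
    where
    ∉y : All (_≢ y) (x ∷ ms ∷ʳ y′)
    ∉y = x≢y ∷ All.∷ʳ⁺ (All.map (λ lt → <μ⇒≢ (<-trans lt (⊔-lub μx<μy μy′<μy))) below) (<μ⇒≢ μy′<μy)

  higher-positive : ∀ {x y} → V x → V y → x ≢ y → μ y ≤ μ x → 0 < μ x
  higher-positive {y = y} vx vy x≢y μy≤μx = n≢0⇒n>0 λ μx≡0 →
    x≢y (ground-unique vx vy μx≡0 (n≤0⇒n≡0 (subst (μ y ≤_) μx≡0 μy≤μx)))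

  -- Descending from the higher endpoint keeps every interior vertex strictly below it, so the
  -- endpoint added back is distinct from the vertices already on the path.
  path : ∀ b {x y} → V x → V y → x ≢ y → μ x + μ y < b → Path x y
  path (suc b) {x} {y} vx vy x≢y bound with μ y ≤? μ x
  ... | yes μy≤μx with descend vx (higher-positive vx vy x≢y μy≤μx)
  ...   | x′ , x~x′ , μx′<μx with x′ ≟C y
  ...     | yes refl = edge-path x~x′ x≢y
  ...     | no  x′≢y = prepend x~x′ μx′<μx μy≤μx x≢y
    (path b (~-V x~x′) vy x′≢y (<-≤-trans (+-monoˡ-< (μ y) μx′<μx) (s≤s⁻¹ bound)))
  path (suc b) {x} {y} vx vy x≢y bound | no μy≰μx with descend vy (≤-<-trans z≤n (≰⇒> μy≰μx))
  ...   | y′ , y~y′ , μy′<μy with y′ ≟C x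
  ...     | yes refl = edge-path (~-sym y~y′) x≢y
  ...     | no  y′≢x = append
    (path b vx (~-V y~y′) (≢-sym y′≢x) (<-≤-trans (+-monoʳ-< (μ x) μy′<μy) (s≤s⁻¹ bound)))
    (~-sym y~y′) (≰⇒> μy≰μx) μy′<μy x≢y

  cycle-at-two-lower-neighbours : ∀ {d a b} → V a → V b → d ~ a → d ~ b → a ≢ b →
                                  μ a < μ d → μ b < μ d → Cycle _~_
  cycle-at-two-lower-neighbours {d} {a} {b} va vb d~a d~b a≢b μa<μd μb<μd
    with path _ va vb a≢b ≤-refl
  ... | ms , walk , uniq , below =
    d , a ∷ ms ∷ʳ b ,
    subst (λ l → 3 ≤ suc (suc l)) (sym (length-∷ʳ ms)) (s≤s (s≤s (s≤s z≤n))) ,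
    d∉ ∷ uniq ,
    d~a ∷ linked-∷ʳ (a ∷ ms) walk (~-sym d~b)
    where
    d∉ : All (d ≢_) (a ∷ ms ∷ʳ b)
    d∉ = ≢-sym (<μ⇒≢ μa<μd) ∷
         All.∷ʳ⁺ (All.map (λ lt → ≢-sym (<μ⇒≢ (<-trans lt (⊔-lub μa<μd μb<μd)))) below)
                 (≢-sym (<μ⇒≢ μb<μd))

-- The dot graph of a grid

level : ∀ {m n} → Cell m n → ℕ
level (i , j) = toℕ i + toℕ j

level-zero-unique : ∀ {m n} {x y : Cell m n} → level x ≡ 0 → level y ≡ 0 → x ≡ y
level-zero-unique {x = i , j} {i′ , j′} lx ly =
  cong₂ _,_ (toℕ-injective (trans (m+n≡0⇒m≡0 (toℕ i) lx) (sym (m+n≡0⇒m≡0 (toℕ i′) ly))))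
            (toℕ-injective (trans (m+n≡0⇒n≡0 (toℕ i) lx) (sym (m+n≡0⇒n≡0 (toℕ i′) ly))))

module _ {m n : ℕ} (D : Grid m n) where

  -- DotLeft D i j and DotAbove D i j are, definitionally, Row.Before i j and Col.Before j i.
  private
    module Row (i : Fin m) = Line (D i)
    module Col (j : Fin n) = Line (λ i → D i j)

  Supported Unambiguous Complete : Set
  Supported = ∀ i j → Dotted D i j → ¬ (toℕ i ≡ 0 × toℕ j ≡ 0) → DotLeft D i j ⊎ DotAbove D i j
  Unambiguous = ∀ i j → Dotted D i j → DotLeft D i j → DotAbove D i j → ⊥
  Complete = ∀ i j → Dotted D i j →
    (DotBelow D i j × DotRight D i j) ⊎ (¬ DotBelow D i j × ¬ DotRight D i j)

  left? : ∀ i j → Dec (DotLeft D i j)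
  left? i = Row.before? i

  above? : ∀ i j → Dec (DotAbove D i j)
  above? i j = Col.before? j i

  private
    gap⇒no-between : ∀ {k} (L : Fin k → Bool) {x y} → y <ᶠ x → Line.Gap L y x →
                     ∀ z → Between D (toℕ x) (toℕ z) (toℕ y) → ¬ Line.Dot L z
    gap⇒no-between L y<x gap z (inj₁ (x<z , z<y)) = contradiction (<-trans x<z z<y) (<-asym y<x)
    gap⇒no-between L y<x gap z (inj₂ (y<z , z<x)) = gap z y<z z<x

    no-between⇒gap : ∀ {k} (L : Fin k → Bool) {x y} →
                     (∀ z → Between D (toℕ x) (toℕ z) (toℕ y) → ¬ Line.Dot L z) → Line.Gap L y x
    no-between⇒gap L no-between z y<z z<x = no-between z (inj₂ (y<z , z<x))

  Adj-sym : Symmetric (Adj D)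
  Adj-sym (dx , dy , x≢y , inj₁ (refl , no-between)) =
    dy , dx , (λ (e , e′) → x≢y (sym e , sym e′)) , inj₁ (refl , λ k → no-between k ∘ Sum.swap)
  Adj-sym (dx , dy , x≢y , inj₂ (refl , no-between)) =
    dy , dx , (λ (e , e′) → x≢y (sym e , sym e′)) , inj₂ (refl , λ k → no-between k ∘ Sum.swap)

  Adj-dotted : ∀ {x y} → Adj D x y → Dotted D (proj₁ y) (proj₂ y)
  Adj-dotted (_ , dy , _) = dy

  level-differs : ∀ {x y} → Adj D x y → level x ≢ level y
  level-differs {i , _} (_ , _ , x≢y , inj₁ (refl , _)) eq =
    x≢y (refl , toℕ-injective (+-cancelˡ-≡ (toℕ i) _ _ eq))
  level-differs {_ , j} (_ , _ , x≢y , inj₂ (refl , _)) eq =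
    x≢y (toℕ-injective (+-cancelʳ-≡ (toℕ j) _ _ eq) , refl)

  left-neighbour : ∀ {i j} → Dotted D i j → DotLeft D i j →
                   Σ (Fin n) λ j′ → Adj D (i , j) (i , j′) × level (i , j′) < level (i , j)
  left-neighbour {i} {j} dij left with Row.nearest-before i left
  ... | j′ , j′<j , dj′ , gap =
    j′ , (dij , dj′ , (λ (_ , j≡j′) → <-irrefl (cong toℕ (sym j≡j′)) j′<j) ,
          inj₁ (refl , gap⇒no-between (D i) j′<j gap)) ,
    +-monoʳ-< (toℕ i) j′<j

  above-neighbour : ∀ {i j} → Dotted D i j → DotAbove D i j →
                    Σ (Fin m) λ i′ → Adj D (i , j) (i′ , j) × level (i′ , j) < level (i , j)
  above-neighbour {i} {j} dij above with Col.nearest-before j above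
  ... | i′ , i′<i , di′ , gap =
    i′ , (dij , di′ , (λ (i≡i′ , _) → <-irrefl (cong toℕ (sym i≡i′)) i′<i) ,
          inj₂ (refl , gap⇒no-between (λ x → D x j) i′<i gap)) ,
    +-monoˡ-< (toℕ j) i′<i

  descend : Supported → ∀ {x} → Dotted D (proj₁ x) (proj₂ x) → 0 < level x →
            Σ (Cell m n) λ y → Adj D x y × level y < level x
  descend supported {i , j} dx 0<level
    with supported i j dx (λ (i≡0 , j≡0) → <-irrefl (sym (cong₂ _+_ i≡0 j≡0)) 0<level)
  ... | inj₁ left  = let j′ , down = left-neighbour dx left in (i , j′) , down
  ... | inj₂ above = let i′ , down = above-neighbour dx above in (i′ , j) , down

  private
    row-< : ∀ {i : Fin m} {j j′ : Fin n} → level (i , j′) < level (i , j) → j′ <ᶠ j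
    row-< {i} = +-cancelˡ-< (toℕ i) _ _

    col-< : ∀ {i i′ : Fin m} {j : Fin n} → level (i′ , j) < level (i , j) → i′ <ᶠ i
    col-< {j = j} = +-cancelʳ-< (toℕ j) _ _

  lower-neighbour-unique : Unambiguous → ∀ {w a b} → Adj D w a → Adj D w b →
                           level a < level w → level b < level w → a ≡ b
  lower-neighbour-unique _ {i , _}
    (_ , da , _ , inj₁ (refl , no-between)) (_ , db , _ , inj₁ (refl , no-between′)) la lb =
    cong (i ,_) (Row.nearest-unique i (row-< la) (row-< lb) da db
                  (no-between⇒gap (D i) no-between) (no-between⇒gap (D i) no-between′))
  lower-neighbour-unique _ {_ , j}
    (_ , da , _ , inj₂ (refl , no-between)) (_ , db , _ , inj₂ (refl , no-between′)) la lb =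
    cong (_, j) (Col.nearest-unique j (col-< la) (col-< lb) da db
                  (no-between⇒gap (λ x → D x j) no-between) (no-between⇒gap (λ x → D x j) no-between′))
  lower-neighbour-unique unambiguous {i , j} {_ , ja} {ib , _}
    (dw , da , _ , inj₁ (refl , _)) (_ , db , _ , inj₂ (refl , _)) la lb =
    ⊥-elim (unambiguous i j dw (ja , row-< la , da) (ib , col-< lb , db))
  lower-neighbour-unique unambiguous {i , j} {ia , _} {_ , jb}
    (dw , da , _ , inj₂ (refl , _)) (_ , db , _ , inj₁ (refl , _)) la lb =
    ⊥-elim (unambiguous i j dw (jb , row-< lb , db) (ia , col-< la , da))

  private
    module Descent (supported : Supported) =
      Descending (Adj D) level (λ (i , j) → Dotted D i j) (≡-dec _≟_ _≟_)
                 Adj-sym Adj-dotted (λ _ _ → level-zero-unique) (descend supported)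

  connected : Supported → Connected D
  connected supported _ _ _ _ = Descent.connected supported

  acyclic : Unambiguous → ¬ HasCycle D
  acyclic unambiguous =
    PeakFree.acyclic (Adj D) level Adj-sym level-differs (lower-neighbour-unique unambiguous)

  unambiguous : Supported → ¬ HasCycle D → Unambiguous
  unambiguous supported no-cycle i j dij left above
    with left-neighbour dij left | above-neighbour dij above
  ... | ja , wa , la | ib , wb , lb =
    no-cycle (Descent.cycle-at-two-lower-neighbours supported (Adj-dotted wa) (Adj-dotted wb) wa wb
                (λ a≡b → <-irrefl (cong (λ (_ , j′) → toℕ i + toℕ j′) a≡b) la) la lb)

  exactly-one-parent : Supported → Unambiguous →
    ∀ i j → Dotted D i j → ¬ (toℕ i ≡ 0 × toℕ j ≡ 0) →
    (DotAbove D i j × ¬ DotLeft D i j) ⊎ (¬ DotAbove D i j × DotLeft D i j)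
  exactly-one-parent supported unambiguous i j dij ¬origin with supported i j dij ¬origin
  ... | inj₁ left  = inj₂ (unambiguous i j dij left , left)
  ... | inj₂ above = inj₁ (above , λ left → unambiguous i j dij left above)

  roots-at-origin : Supported → ∀ {i j} → IsRoot D i j → toℕ i ≡ 0 × toℕ j ≡ 0
  roots-at-origin supported {i} {j} (dij , ¬left , ¬above) =
    decidable-stable ((toℕ i ≟ℕ 0) ×-dec (toℕ j ≟ℕ 0))
                     (λ ¬origin → [ ¬left , ¬above ]′ (supported i j dij ¬origin))

  dots-with-dot-left : (∀ i → ∃ (Dotted D i)) →
    ∑₂ (λ i j → χ (D i j)) ≡ m + ∑₂ (λ i j → χ (D i j ∧ does (left? i j)))
  dots-with-dot-left rows = begin
    ∑₂ (λ i j → χ (D i j))                    ≡⟨ sum-cong-≗ (λ i → Row.dots-with-dot-before i (rows i)) ⟩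
    ∑[ i < m ] (1 + ∑[ j < n ] with-left i j) ≡⟨ ∑-distrib-+ (λ _ → 1) (λ i → ∑[ j < n ] with-left i j) ⟩
    ∑[ i < m ] 1 + ∑₂ with-left               ≡⟨ cong (_+ ∑₂ with-left) (∑-1 m) ⟩
    m + ∑₂ with-left                          ∎
    where
    with-left : Fin m → Fin n → ℕ
    with-left i j = χ (D i j ∧ does (left? i j))

-- DotAbove D i j is, definitionally, DotLeft of the transposed grid at (j , i).
dots-with-dot-above : ∀ {m n} (D : Grid m n) → (∀ j → ∃ λ i → Dotted D i j) →
  ∑₂ (λ i j → χ (D i j)) ≡ n + ∑₂ (λ i j → χ (D i j ∧ does (above? D i j)))
dots-with-dot-above D cols =
  trans (∑-comm (λ i j → χ (D i j)))
        (trans (dots-with-dot-left (λ j i → D i j) cols)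
               (cong (_ +_) (∑-comm (λ j i → χ (D i j ∧ does (above? D i j))))))

module _ {m n : ℕ} (D : Grid (suc m) (suc n)) where

  top-row-root : ∃ (Dotted D zero) → ∃ (IsRoot D zero)
  top-row-root top with Line.first (D zero) top
  ... | j , d , ¬left = j , d , ¬left , λ ()

  left-column-root : ∃ (λ i → Dotted D i zero) → ∃ (λ i → IsRoot D i zero)
  left-column-root left with Line.first (λ i → D i zero) left
  ... | i , d , ¬above = i , d , (λ ()) , ¬above

  single-root⇒supported : SingleRoot D → ∃ (Dotted D zero) → ∃ (λ i → Dotted D i zero) → Supported D
  single-root⇒supported ((r , c) , _ , root-unique) top left i j dij ¬origin
    with left? D i j | above? D i j
  ... | yes left | _         = inj₁ left
  ... | no _     | yes above = inj₂ above
  ... | no ¬left | no ¬above =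
    let i≡r , j≡c = root-unique i j (dij , ¬left , ¬above)
        0≡r , _   = root-unique zero _ (proj₂ (top-row-root top))
        _   , 0≡c = root-unique _ zero (proj₂ (left-column-root left))
    in contradiction (cong toℕ (trans i≡r (sym 0≡r)) , cong toℕ (trans j≡c (sym 0≡c))) ¬origin

  module _ (nab : IsNAB D) where

    private
      rows : ∀ i → ∃ (Dotted D i)
      rows = proj₁ nab

      cols : ∀ j → ∃ λ i → Dotted D i j
      cols = proj₁ (proj₂ nab)

      one-parent : ∀ i j → Dotted D i j → ¬ (toℕ i ≡ 0 × toℕ j ≡ 0) →
               (DotAbove D i j × ¬ DotLeft D i j) ⊎ (¬ DotAbove D i j × DotLeft D i j)
      one-parent = proj₂ (proj₂ nab)

    nab⇒supported : Supported D
    nab⇒supported i j dij ¬origin = [ inj₂ ∘ proj₁ , inj₁ ∘ proj₂ ]′ (one-parent i j dij ¬origin)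

    nab⇒unambiguous : Unambiguous D
    nab⇒unambiguous i j dij left@(j′ , j′<j , _) above
      with one-parent i j dij (λ (_ , j≡0) → n≮0 (subst (toℕ j′ <_) j≡0 j′<j))
    ... | inj₁ (_ , ¬left)  = ¬left left
    ... | inj₂ (¬above , _) = ¬above above

    nab⇒tree : IsTreeGraph D
    nab⇒tree = connected D nab⇒supported , acyclic D nab⇒unambiguous

    origin-dotted : Dotted D zero zero
    origin-dotted with top-row-root (rows zero)
    ... | j , root@(dj , _) =
      subst (Dotted D zero) (toℕ-injective (proj₂ (roots-at-origin D nab⇒supported root))) dj

    nab⇒single-root : SingleRoot D
    nab⇒single-root =
      (zero , zero) , (origin-dotted , (λ ()) , λ ()) ,
      λ _ _ root → Product.map toℕ-injective toℕ-injective (roots-at-origin D nab⇒supported root)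

    χ-parents : ∀ {i j} → Dotted D i j → ¬ (toℕ i ≡ 0 × toℕ j ≡ 0) →
                χ (does (left? D i j)) + χ (does (above? D i j)) ≡ 1
    χ-parents {i} {j} dij ¬origin =
      χ-exactly-one (left? D i j) (above? D i j) (nab⇒unambiguous i j dij)
        (λ ¬left → [ proj₁ , (λ (_ , left) → contradiction left ¬left) ]′ (one-parent i j dij ¬origin))

    χ-dot-split : ∀ i j → χ (D i j) ≡ χ (⌊ i ≟ zero ⌋ ∧ ⌊ j ≟ zero ⌋) +
                          (χ (D i j ∧ does (left? D i j)) + χ (D i j ∧ does (above? D i j)))
    χ-dot-split i j with D i j in dij | i ≟ zero | j ≟ zero
    ... | false | yes refl | yes refl = contradiction (trans (sym dij) origin-dotted) λ ()
    ... | false | yes _    | no _     = refl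
    ... | false | no _     | _        = refl
    ... | true  | yes refl | yes refl =
      cong suc (sym (χ-neither (left? D zero zero) (above? D zero zero) (λ ()) (λ ())))
    ... | true  | yes refl | no j≢0   = sym (χ-parents dij λ (_ , j≡0) → j≢0 (toℕ-injective j≡0))
    ... | true  | no i≢0   | _        = sym (χ-parents dij λ (i≡0 , _) → i≢0 (toℕ-injective i≡0))

    nab-size : suc (∑₂ (λ i j → χ (D i j))) ≡ suc m + suc n
    nab-size = double-count {l = ∑₂ with-left} {∑₂ with-above} {suc m} {suc n}
                 (dots-with-dot-left D rows) (dots-with-dot-above D cols) (begin
      ∑₂ (λ i j → χ (D i j))                              ≡⟨ ∑₂-cong χ-dot-split ⟩
      ∑₂ (λ i j → origin i j + (with-left i j + with-above i j))
        ≡⟨ ∑₂-distrib-+ origin (λ i j → with-left i j + with-above i j) ⟩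
      ∑₂ origin + ∑₂ (λ i j → with-left i j + with-above i j)
        ≡⟨ cong₂ _+_ (∑₂-origin {m} {n}) (∑₂-distrib-+ with-left with-above) ⟩
      suc (∑₂ with-left + ∑₂ with-above)                  ∎)
      where
      origin with-left with-above : Fin (suc m) → Fin (suc n) → ℕ
      origin     i j = χ (⌊ i ≟ zero ⌋ ∧ ⌊ j ≟ zero ⌋)
      with-left  i j = χ (D i j ∧ does (left? D i j))
      with-above i j = χ (D i j ∧ does (above? D i j))

module _ {N : ℕ} (π : Permutation′ N) where

  T-true⇒≡ : ∀ {i j} → T π i j ≡ true → i ≡ π ⟨$⟩ʳ j
  T-true⇒≡ {i} {j} t with i ≟ π ⟨$⟩ʳ j
  ... | yes i≡πj = i≡πj
  ... | no  _    = contradiction t λ ()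

  ≡⇒T-true : ∀ {i j} → i ≡ π ⟨$⟩ʳ j → T π i j ≡ true
  ≡⇒T-true {i} {j} i≡πj with i ≟ π ⟨$⟩ʳ j
  ... | yes _    = refl
  ... | no i≢πj = contradiction i≡πj i≢πj

  ≢⇒T-false : ∀ {i j} → i ≢ π ⟨$⟩ʳ j → T π i j ≡ false
  ≢⇒T-false {i} {j} i≢πj with i ≟ π ⟨$⟩ʳ j
  ... | yes i≡πj = contradiction i≡πj i≢πj
  ... | no  _    = refl

  ∑₂-permutation : ∑₂ (λ i j → χ (T π i j)) ≡ N
  ∑₂-permutation =
    trans (∑-comm (λ i j → χ (T π i j))) (trans (sum-cong-≗ (λ j → ∑-δ (π ⟨$⟩ʳ j))) (∑-1 N))

-- From a CMNAB with a single root to a CNAB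

module FromCMNAB {N : ℕ} {D : Grid N N} (π : Permutation′ N) (I : Grid N N)
  (D≡T∨I : ∀ i j → D i j ≡ (T π i j ∨ I i j))
  (I-branches : ∀ i j → I i j ≡ true → DotBelow D i j × DotRight D i j)
  where

  T⇒dotted : ∀ {i j} → T π i j ≡ true → Dotted D i j
  T⇒dotted {i} {j} t = trans (D≡T∨I i j) (cong (_∨ I i j) t)

  internal : ∀ {i j} → Dotted D i j → T π i j ≡ false → I i j ≡ true
  internal {i} {j} dij t = trans (sym (trans (D≡T∨I i j) (cong (_∨ I i j) t))) dij

  rows : ∀ i → ∃ (Dotted D i)
  rows i = π ⟨$⟩ˡ i , T⇒dotted (≡⇒T-true π (sym (inverseʳ π)))

  cols : ∀ j → ∃ λ i → Dotted D i j
  cols j = π ⟨$⟩ʳ j , T⇒dotted (≡⇒T-true π refl)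

  T-leaf : ∀ {i j} → T π i j ≡ true → ¬ DotBelow D i j × ¬ DotRight D i j
  T-leaf {i} {j} t =
    Line.only-exception-is-last (λ x → D x j) others-below (T⇒dotted t) ,
    Line.only-exception-is-last (D i) others-right (T⇒dotted t)
    where
    i≡πj : i ≡ π ⟨$⟩ʳ j
    i≡πj = T-true⇒≡ π t
    others-below : ∀ x → Dotted D x j → x ≢ i → DotBelow D x j
    others-below x dx x≢i =
      proj₁ (I-branches x j (internal dx (≢⇒T-false π (λ x≡πj → x≢i (trans x≡πj (sym i≡πj))))))
    others-right : ∀ y → Dotted D i y → y ≢ j → DotRight D i y
    others-right y dy y≢j =
      proj₂ (I-branches i y (internal dy (≢⇒T-false π (λ i≡πy →
        y≢j (Injection.injective (↔⇒↣ π) (trans (sym i≡πy) i≡πj))))))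

  complete : Complete D
  complete i j dij with T π i j in t
  ... | true  = inj₂ (T-leaf t)
  ... | false = inj₁ (I-branches i j (internal dij t))

cmnab⇒cnab : ∀ {n} (D : Grid (suc n) (suc n)) → IsCMNAB D → SingleRoot D → IsCNAB D
cmnab⇒cnab D (π , I , _ , _ , D≡T∨I , I-branches , _ , no-cycle) single-root =
  (rows , cols , exactly-one-parent D supported (unambiguous D supported no-cycle)) , complete
  where
  open FromCMNAB π I D≡T∨I I-branches
  supported : Supported D
  supported = single-root⇒supported D single-root (rows zero) (cols zero)

-- From a CNAB to a CMNAB

∨-split : ∀ d t → (t ≡ true → d ≡ true) → d ≡ t ∨ (d ∧ not t)
∨-split false false _   = refl
∨-split true  false _   = refl
∨-split true  true  _   = refl
∨-split false true  t⇒d = t⇒d refl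

χ-split : ∀ d t → (t ≡ true → d ≡ true) → χ d ≡ χ (d ∧ not t) + χ t
χ-split false false _   = refl
χ-split true  false _   = refl
χ-split true  true  _   = refl
χ-split false true  t⇒d = contradiction (t⇒d refl) λ ()

∧-not-true : ∀ d t → d ∧ not t ≡ true → d ≡ true × t ≡ false
∧-not-true true false _ = refl , refl

module FromCNAB {n : ℕ} (D : Grid (suc n) (suc n)) (nab : IsNAB D) (complete : Complete D) where

  N : ℕ
  N = suc n

  no-right⇒no-below : ∀ {i j} → Dotted D i j → ¬ DotRight D i j → ¬ DotBelow D i j
  no-right⇒no-below {i} {j} dij ¬right below with complete i j dij
  ... | inj₁ (_ , right)  = ¬right right
  ... | inj₂ (¬below , _) = ¬below below

  no-below⇒no-right : ∀ {i j} → Dotted D i j → ¬ DotBelow D i j → ¬ DotRight D i j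
  no-below⇒no-right {i} {j} dij ¬below right with complete i j dij
  ... | inj₁ (below , _)  = ¬below below
  ... | inj₂ (_ , ¬right) = ¬right right

  lowest : ∀ j → Σ (Fin N) λ i → Dotted D i j × ¬ DotBelow D i j
  lowest j = Line.last (λ i → D i j) (proj₁ (proj₂ nab) j)

  rightmost : ∀ i → Σ (Fin N) λ j → Dotted D i j × ¬ DotRight D i j
  rightmost i = Line.last (D i) (proj₁ nab i)

  lowest-unique : ∀ {i j} → Dotted D i j → ¬ DotBelow D i j → i ≡ proj₁ (lowest j)
  lowest-unique {j = j} dij ¬below =
    let _ , d , ¬b = lowest j in Line.last-unique (λ x → D x j) dij ¬below d ¬b

  rightmost-unique : ∀ {i j} → Dotted D i j → ¬ DotRight D i j → j ≡ proj₁ (rightmost i)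
  rightmost-unique {i} dij ¬right =
    let _ , d , ¬r = rightmost i in Line.last-unique (D i) dij ¬right d ¬r

  π : Permutation′ N
  π = permutation (proj₁ ∘ lowest) (proj₁ ∘ rightmost)
    (λ i → let _ , d , ¬right = rightmost i in sym (lowest-unique d (no-right⇒no-below d ¬right)))
    (λ j → let _ , d , ¬below = lowest j in sym (rightmost-unique d (no-below⇒no-right d ¬below)))

  leaf⇒T : ∀ {i j} → Dotted D i j → ¬ DotBelow D i j → T π i j ≡ true
  leaf⇒T dij ¬below = ≡⇒T-true π (lowest-unique dij ¬below)

  T⇒dotted : ∀ {i j} → T π i j ≡ true → Dotted D i j
  T⇒dotted {j = j} t = subst (λ x → Dotted D x j) (sym (T-true⇒≡ π t)) (proj₁ (proj₂ (lowest j)))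

  I : Grid N N
  I i j = D i j ∧ not (T π i j)

  I-branches : ∀ i j → I i j ≡ true → DotBelow D i j × DotRight D i j
  I-branches i j e with ∧-not-true (D i j) (T π i j) e
  ... | dij , not-T with complete i j dij
  ...   | inj₁ branches     = branches
  ...   | inj₂ (¬below , _) = contradiction (trans (sym not-T) (leaf⇒T dij ¬below)) λ ()

  internal-count : count I ≡ n
  internal-count = begin
    count I     ≡⟨ count≡∑₂ I ⟩
    ∑₂ internal ≡⟨ suc-injective (+-cancelʳ-≡ N _ _ internal+1+N≡N+N) ⟩
    n           ∎
    where
    internal : Fin N → Fin N → ℕ
    internal i j = χ (I i j)
    dots≡internal+N : ∑₂ (λ i j → χ (D i j)) ≡ ∑₂ internal + N
    dots≡internal+N =
      trans (∑₂-cong (λ i j → χ-split (D i j) (T π i j) T⇒dotted))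
            (trans (∑₂-distrib-+ internal (λ i j → χ (T π i j)))
                   (cong (∑₂ internal +_) (∑₂-permutation π)))
    internal+1+N≡N+N : suc (∑₂ internal) + N ≡ N + N
    internal+1+N≡N+N = trans (cong suc (sym dots≡internal+N)) (nab-size D nab)

  cmnab : IsCMNAB D
  cmnab = π , I , (λ i j → proj₂ ∘ ∧-not-true (D i j) (T π i j)) , internal-count ,
          (λ i j → ∨-split (D i j) (T π i j) T⇒dotted) , I-branches , nab⇒tree D nab

proposition4p11 : (n : ℕ) (D : Grid (suc n) (suc n)) →
    (IsCNAB D → IsCMNAB D × SingleRoot D) × (IsCMNAB D × SingleRoot D → IsCNAB D)
proposition4p11 n D =
  (λ (nab , complete) → FromCNAB.cmnab D nab complete , nab⇒single-root D nab) ,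
  (λ (cmnab , single-root) → cmnab⇒cnab D cmnab single-root)
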